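{- For any finite undirected graph $G=(V,E)$ and any bijective vertex order $\pi\colon V\to\{1,\dots,|V|\}$ there are positive edge weights $\ell$ such that, for the canonical HHL $L$ of $(G,\ell)$ respecting $\pi$, the CCH graph $G^*$ of $G$ with respect to $\pi$ satisfies $L(v)=\mathit{SS}(v)$ for all $v\in V$.
   Context: For positive edge weights $\ell$, the canonical HHL of $(G,\ell)$ respecting $\pi$ is the labeling $L\colon V\to 2^V$ with $u\in L(v)$ if and only if $u$ has maximum rank among all vertices on every shortest $v$-$u$-path. The CCH graph $G^*$ of $G$ w.r.t. $\pi$ contains the edges of $G$ and an edge $\{v,w\}$ whenever there is a simple $v$-$w$-path in $G$ whose interior vertices $u$ all satisfy $\pi(u)<\min\{\pi(v),\pi(w)\}$. $\mathit{SS}(v)$ is the set of vertices reachable from $v$ in $G^*$ via a path whose ranks are increasing with respect to $\pi$ (including $v$). -}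

module Defs where

open import Data.Nat using (ℕ; _+_; _≤_; _<_)
open import Data.Bool using (Bool; T)
open import Data.Fin using (Fin)
import Data.Fin as F
open import Data.Fin.Permutation using (Permutation′; _⟨$⟩ʳ_)
open import Data.List using (List; []; _∷_)
open import Data.List.Membership.Propositional using (_∈_)
open import Data.List.Relation.Unary.Unique.Propositional using (Unique)
open import Data.Product using (Σ; _×_; ∃)
open import Data.Sum using (_⊎_)
open import Relation.Binary.PropositionalEquality using (_≡_)
open import Relation.Nullary using (¬_)

record Graph (n : ℕ) : Set where
  field
    adj    : Fin n → Fin n → Bool
    sym    : ∀ u v → adj u v ≡ adj v u
    irrefl : ∀ v → adj v v ≡ Data.Bool.false
open Graph public

Edge : ∀ {n} → Graph n → Fin n → Fin n → Set
Edge G u v = T (adj G u v)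

IsWeighting : ∀ {n} → Graph n → (Fin n → Fin n → ℕ) → Set
IsWeighting G ℓ = (∀ u v → ℓ u v ≡ ℓ v u) × (∀ u v → Edge G u v → 1 ≤ ℓ u v)

data Walk {n} (G : Graph n) : Fin n → Fin n → Set where
  [] : ∀ {v} → Walk G v v
  cons : ∀ {v w u} → Edge G v w → Walk G w u → Walk G v u

verts : ∀ {n} {G : Graph n} {v u} → Walk G v u → List (Fin n)
verts {v = v} [] = v ∷ []
verts {v = v} (cons _ p) = v ∷ verts p

len : ∀ {n} {G : Graph n} → (Fin n → Fin n → ℕ) → ∀ {v u} → Walk G v u → ℕ
len ℓ [] = 0
len ℓ (cons {v} {w} _ p) = ℓ v w + len ℓ p

Shortest : ∀ {n} {G : Graph n} → (Fin n → Fin n → ℕ) → ∀ {v u} → Walk G v u → Set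
Shortest {G = G} ℓ {v} {u} p = ∀ (q : Walk G v u) → len ℓ p ≤ len ℓ q

rank : ∀ {n} → Permutation′ n → Fin n → Fin n
rank π x = π ⟨$⟩ʳ x

InHHL : ∀ {n} → Graph n → (Fin n → Fin n → ℕ) → Permutation′ n → Fin n → Fin n → Set
InHHL G ℓ π v u =
  Walk G v u ×
  (∀ (p : Walk G v u) → Shortest ℓ p → ∀ x → x ∈ verts p → rank π x F.≤ rank π u)

CCHEdge : ∀ {n} → Graph n → Permutation′ n → Fin n → Fin n → Set
CCHEdge G π v w =
  ¬ (v ≡ w) ×
  Σ (Walk G v w) λ p → Unique (verts p) ×
    (∀ x → x ∈ verts p →
       x ≡ v ⊎ x ≡ w ⊎ (rank π x F.< rank π v × rank π x F.< rank π w))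

data SS {n} (G : Graph n) (π : Permutation′ n) : Fin n → Fin n → Set where
  here : ∀ {v} → SS G π v v
  step : ∀ {v w u} → CCHEdge G π v w → rank π v F.< rank π w → SS G π w u → SS G π v u

-- Weight every edge by B ^ (larger rank of its endpoints), with B = n + 1. A simple walk
-- whose vertices all have rank at most R is then shorter than B ^ (R + 1), while every
-- walk through a vertex of rank above R (other than its target) is at least that long.
-- Hence u ∈ L(v) exactly when some v-u walk stays at ranks ≤ rank u, and the latter
-- characterises SS(v): cutting such a walk at each new rank maximum yields the
-- rank-increasing sequence of CCH edges, and conversely the concatenated CCH witness
-- paths never exceed the rank of u.
module Submission where

open import Defs hiding (sym)
open import Data.Nat using (ℕ; zero; suc; _+_; _*_; _^_; _≤_; _<_; z≤n; s≤s; _⊔_; _<?_)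
open import Data.Nat.Properties hiding (_≟_)
open import Data.Bool using (T?)
open import Data.Bool.Properties using (T-irrelevant)
open import Data.Fin as F using (Fin; toℕ; _≟_)
import Data.Fin.Properties as FinP
open import Data.Fin.Permutation using (Permutation′)
open import Data.List using (List; []; _∷_; _++_; map; concatMap; length; lookup; allFin)
open import Data.List.Extrema.Nat using (argmin; f[argmin]≤f[xs])
open import Data.List.Membership.Propositional using (_∈_)
open import Data.List.Membership.Propositional.Properties
  using (∈-map⁺; ∈-concatMap⁺; ∈-allFin; ∈-++⁺ˡ; ∈-++⁺ʳ; ∈-lookup)
open import Data.List.Relation.Binary.Subset.Propositional using (_⊆_)
open import Data.List.Relation.Unary.All as All using ()
open import Data.List.Relation.Unary.All.Properties using (¬Any⇒All¬)
open import Data.List.Relation.Unary.Any as Any using (here; there; any?)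
open import Data.List.Relation.Unary.AllPairs using ([]; _∷_)
open import Data.List.Relation.Unary.Unique.Propositional using (Unique)
open import Data.Product using (Σ; _×_; _,_)
open import Data.Sum using (_⊎_; inj₁; inj₂; [_,_]′)
open import Function using (_∘_)
open import Function.Bundles using (_⇔_; mk⇔; Injection)
open import Function.Construct.Composition using (_⇔-∘_)
open import Function.Construct.Symmetry using (⇔-sym)
open import Function.Properties.Inverse using (↔⇒↣)
open import Relation.Nullary using (Dec; yes; no; contradiction)
open import Relation.Binary.PropositionalEquality

lookup-injective : ∀ {a} {A : Set a} {xs : List A} → Unique xs →
                   ∀ {i j} → lookup xs i ≡ lookup xs j → i ≡ j
lookup-injective {xs = _ ∷ _} (_ ∷ _) {F.zero} {F.zero} _ = refl
lookup-injective {xs = _ ∷ _} (x∉ ∷ _) {F.zero} {F.suc j} eq =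
  contradiction eq (All.lookup x∉ (∈-lookup j))
lookup-injective {xs = _ ∷ _} (x∉ ∷ _) {F.suc i} {F.zero} eq =
  contradiction (sym eq) (All.lookup x∉ (∈-lookup i))
lookup-injective {xs = _ ∷ _} (_ ∷ unique) {F.suc i} {F.suc j} eq =
  cong F.suc (lookup-injective unique eq)

Unique⇒length≤ : ∀ {n} {xs : List (Fin n)} → Unique xs → length xs ≤ n
Unique⇒length≤ unique = FinP.injective⇒≤ (lookup-injective unique)

module _ {n : ℕ} {G : Graph n} where

  edges : ∀ {v u} → Walk G v u → ℕ
  edges [] = 0
  edges (cons _ p) = suc (edges p)

  length-verts : ∀ {v u} (p : Walk G v u) → length (verts p) ≡ suc (edges p)
  length-verts [] = refl
  length-verts (cons _ p) = cong suc (length-verts p)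

  Unique⇒edges<n : ∀ {v u} {p : Walk G v u} → Unique (verts p) → edges p < n
  Unique⇒edges<n {p = p} unique = subst (_≤ n) (length-verts p) (Unique⇒length≤ unique)

  source∈verts : ∀ {v u} (p : Walk G v u) → v ∈ verts p
  source∈verts [] = here refl
  source∈verts (cons _ _) = here refl

  target∈verts : ∀ {v u} (p : Walk G v u) → u ∈ verts p
  target∈verts [] = here refl
  target∈verts (cons _ p) = there (target∈verts p)

  infixr 5 _++ʷ_
  _++ʷ_ : ∀ {v w u} → Walk G v w → Walk G w u → Walk G v u
  [] ++ʷ q = q
  cons e p ++ʷ q = cons e (p ++ʷ q)

  ∈-verts-++ʷ⁻ : ∀ {v w u x} (p : Walk G v w) (q : Walk G w u) →
                 x ∈ verts (p ++ʷ q) → x ∈ verts p ⊎ x ∈ verts q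
  ∈-verts-++ʷ⁻ [] q x∈ = inj₂ x∈
  ∈-verts-++ʷ⁻ (cons e p) q (here refl) = inj₁ (here refl)
  ∈-verts-++ʷ⁻ (cons e p) q (there x∈) with ∈-verts-++ʷ⁻ p q x∈
  ... | inj₁ x∈p = inj₁ (there x∈p)
  ... | inj₂ x∈q = inj₂ x∈q

  suffix : ∀ {v u x} (p : Walk G v u) → x ∈ verts p → Walk G x u
  suffix [] (here refl) = []
  suffix (cons e p) (here refl) = cons e p
  suffix (cons e p) (there x∈) = suffix p x∈

  verts-suffix⊆ : ∀ {v u x} (p : Walk G v u) (x∈ : x ∈ verts p) → verts (suffix p x∈) ⊆ verts p
  verts-suffix⊆ [] (here refl) = λ y∈ → y∈
  verts-suffix⊆ (cons e p) (here refl) = λ y∈ → y∈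
  verts-suffix⊆ (cons e p) (there x∈) = there ∘ verts-suffix⊆ p x∈

  Unique-suffix : ∀ {v u x} (p : Walk G v u) (x∈ : x ∈ verts p) →
                  Unique (verts p) → Unique (verts (suffix p x∈))
  Unique-suffix [] (here refl) unique = unique
  Unique-suffix (cons e p) (here refl) unique = unique
  Unique-suffix (cons e p) (there x∈) (_ ∷ unique) = Unique-suffix p x∈ unique

  len-suffix≤ : ∀ ℓ {v u x} (p : Walk G v u) (x∈ : x ∈ verts p) → len ℓ (suffix p x∈) ≤ len ℓ p
  len-suffix≤ ℓ [] (here refl) = ≤-refl
  len-suffix≤ ℓ (cons e p) (here refl) = ≤-refl
  len-suffix≤ ℓ (cons {v} {w} e p) (there x∈) = ≤-trans (len-suffix≤ ℓ p x∈) (m≤n+m _ (ℓ v w))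

  record Shortcut {v u} (p : Walk G v u) : Set where
    constructor shortcut
    field
      walk    : Walk G v u
      simple  : Unique (verts walk)
      verts⊆  : verts walk ⊆ verts p
      shorter : ∀ ℓ → len ℓ walk ≤ len ℓ p

  simplify : ∀ {v u} (p : Walk G v u) → Shortcut p
  simplify [] = shortcut [] (All.[] ∷ []) (λ x∈ → x∈) (λ _ → ≤-refl)
  simplify (cons {v} {w} e p) with simplify p
  ... | shortcut q simple q⊆p q≤p with any? (v ≟_) (verts q)
  ...   | yes v∈q = shortcut (suffix q v∈q) (Unique-suffix q v∈q simple)
                      (there ∘ q⊆p ∘ verts-suffix⊆ q v∈q)
                      (λ ℓ → ≤-trans (len-suffix≤ ℓ q v∈q) (≤-trans (q≤p ℓ) (m≤n+m _ (ℓ v w))))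
  ...   | no v∉q = shortcut (cons e q) (¬Any⇒All¬ _ v∉q ∷ simple)
                     (λ { (here eq) → here eq ; (there x∈) → there (q⊆p x∈) })
                     (λ ℓ → +-monoʳ-≤ (ℓ v w) (q≤p ℓ))

  trivialWalks : ∀ v u → List (Walk G v u)
  trivialWalks v u with v ≟ u
  ... | yes refl = [] ∷ []
  ... | no _ = []

  []∈trivialWalks : ∀ v → [] ∈ trivialWalks v v
  []∈trivialWalks v with v ≟ v
  ... | yes refl = here refl
  ... | no v≢v = contradiction refl v≢v

  prepend : ∀ {v w u} → Dec (Edge G v w) → List (Walk G w u) → List (Walk G v u)
  prepend (yes e) ps = map (cons e) ps
  prepend (no _) ps = []

  ∈-prepend⁺ : ∀ {v w u} (e? : Dec (Edge G v w)) (e : Edge G v w) {p : Walk G w u} {ps} →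
               p ∈ ps → cons e p ∈ prepend e? ps
  ∈-prepend⁺ (yes e′) e {p} {ps} p∈ =
    subst (λ e″ → cons e″ p ∈ map (cons e′) ps) (T-irrelevant e′ e) (∈-map⁺ (cons e′) p∈)
  ∈-prepend⁺ (no ¬e) e p∈ = contradiction e ¬e

  walksUpTo : ℕ → ∀ v u → List (Walk G v u)
  walksUpTo zero v u = trivialWalks v u
  walksUpTo (suc k) v u =
    trivialWalks v u ++ concatMap (λ w → prepend (T? (adj G v w)) (walksUpTo k w u)) (allFin n)

  ∈-walksUpTo : ∀ k {v u} (p : Walk G v u) → edges p ≤ k → p ∈ walksUpTo k v u
  ∈-walksUpTo zero {v} [] _ = []∈trivialWalks v
  ∈-walksUpTo (suc k) {v} [] _ = ∈-++⁺ˡ ([]∈trivialWalks v)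
  ∈-walksUpTo (suc k) {v} {u} (cons {w = w} e p) (s≤s p≤k) =
    ∈-++⁺ʳ (trivialWalks v u) (∈-concatMap⁺ (λ w → prepend (T? (adj G v w)) (walksUpTo k w u))
      (Any.map (λ { refl → ∈-prepend⁺ (T? (adj G v w)) e (∈-walksUpTo k p p≤k) }) (∈-allFin w)))

  -- Every walk is dominated by a simple one, and there are finitely many simple walks.
  shortestWalk : ∀ ℓ {v u} → Walk G v u → Σ (Walk G v u) (Shortest ℓ)
  shortestWalk ℓ {v} {u} p = argmin (len ℓ) p candidates , minimal
    where
    candidates : List (Walk G v u)
    candidates = walksUpTo n v u

    minimal : Shortest ℓ (argmin (len ℓ) p candidates)
    minimal q with simplify q
    ... | shortcut q′ simple _ shorter =
      ≤-trans (All.lookup (f[argmin]≤f[xs] p candidates) (∈-walksUpTo n q′ (<⇒≤ (Unique⇒edges<n simple))))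
              (shorter ℓ)

module _ {n : ℕ} (G : Graph n) (π : Permutation′ n) where

  r : Fin n → ℕ
  r x = toℕ (rank π x)

  r-injective : ∀ {x y} → r x ≡ r y → x ≡ y
  r-injective = Injection.injective (↔⇒↣ π) ∘ FinP.toℕ-injective

  RankBounded : ℕ → ∀ {v u} → Walk G v u → Set
  RankBounded R p = ∀ x → x ∈ verts p → r x ≤ R

  SS⇒bounded-walk : ∀ {v u} → SS G π v u → Σ (Walk G v u) (RankBounded (r u))
  SS⇒bounded-walk here = [] , λ { x (here refl) → ≤-refl ; x (there ()) }
  SS⇒bounded-walk {v} {u} (step {w = w} (_ , pw , _ , interior) v<w rest) with SS⇒bounded-walk rest
  ... | q , q-bounded = pw ++ʷ q , λ x x∈ → [ onEdge x ∘ interior x , q-bounded x ]′ (∈-verts-++ʷ⁻ pw q x∈)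
    where
    w≤u : r w ≤ r u
    w≤u = q-bounded w (source∈verts q)

    onEdge : ∀ x → x ≡ v ⊎ x ≡ w ⊎ (rank π x F.< rank π v × rank π x F.< rank π w) → r x ≤ r u
    onEdge x (inj₁ refl) = <⇒≤ (<-≤-trans v<w w≤u)
    onEdge x (inj₂ (inj₁ refl)) = w≤u
    onEdge x (inj₂ (inj₂ (_ , x<w))) = <⇒≤ (<-≤-trans x<w w≤u)

  record FirstExit (R : ℕ) {v u} (p : Walk G v u) : Set where
    constructor exit
    field
      {w}          : Fin n
      above        : R < r w
      prefix       : Walk G v w
      prefix-below : ∀ x → x ∈ verts prefix → x ≡ w ⊎ r x ≤ R
      rest         : Walk G w u
      rest⊆        : verts rest ⊆ verts p

  firstExit : ∀ R {v u} (p : Walk G v u) → RankBounded R p ⊎ FirstExit R p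
  firstExit R {v} p with R <? r v
  ... | yes R<v = inj₂ (exit R<v [] (λ { x (here refl) → inj₁ refl ; x (there ()) }) p (λ x∈ → x∈))
  firstExit R {v} [] | no v≮R = inj₁ (λ { x (here refl) → ≮⇒≥ v≮R ; x (there ()) })
  firstExit R {v} (cons e p) | no v≮R with firstExit R p
  ... | inj₁ bounded = inj₁ (λ { x (here refl) → ≮⇒≥ v≮R ; x (there x∈) → bounded x x∈ })
  ... | inj₂ (exit above pre below rest rest⊆) =
    inj₂ (exit above (cons e pre) (λ { x (here refl) → inj₂ (≮⇒≥ v≮R) ; x (there x∈) → below x x∈ })
               rest (there ∘ rest⊆))

  prefix⇒CCHEdge : ∀ {v w} → r v < r w → (p : Walk G v w) →
                   (∀ x → x ∈ verts p → x ≡ w ⊎ r x ≤ r v) → CCHEdge G π v w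
  prefix⇒CCHEdge {v} {w} v<w p below with simplify p
  ... | shortcut q simple q⊆p _ = (λ { refl → <-irrefl refl v<w }) , q , simple , λ x x∈ → classify x (below x (q⊆p x∈))
    where
    classify : ∀ x → x ≡ w ⊎ r x ≤ r v → x ≡ v ⊎ x ≡ w ⊎ (rank π x F.< rank π v × rank π x F.< rank π w)
    classify x (inj₁ x≡w) = inj₂ (inj₁ x≡w)
    classify x (inj₂ x≤v) with x ≟ v
    ... | yes x≡v = inj₁ x≡v
    ... | no x≢v = inj₂ (inj₂ (x<v , <-trans x<v v<w))
      where
      x<v : r x < r v
      x<v = ≤∧≢⇒< x≤v (x≢v ∘ r-injective)

  -- Each CCH step strictly raises the rank of the current vertex, so the rank gap k shrinks.
  bounded-walk⇒SS : ∀ k {v u} → r u ≤ k + r v → (p : Walk G v u) → RankBounded (r u) p → SS G π v u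
  bounded-walk⇒SS k {v} {u} gap p bounded with firstExit (r v) p
  ... | inj₁ below = subst (SS G π v) (r-injective (≤-antisym (bounded v (source∈verts p)) (below u (target∈verts p)))) here
  bounded-walk⇒SS zero gap p bounded | inj₂ (exit above _ _ rest rest⊆) =
    contradiction (≤-trans (bounded _ (rest⊆ (source∈verts rest))) gap) (<⇒≱ above)
  bounded-walk⇒SS (suc k) {v} {u} gap p bounded | inj₂ (exit {w} above pre below rest rest⊆) =
    step (prefix⇒CCHEdge above pre below) above
         (bounded-walk⇒SS k gap′ rest (λ x x∈ → bounded x (rest⊆ x∈)))
    where
    gap′ : r u ≤ k + r w
    gap′ = ≤-trans gap (≤-trans (≤-reflexive (sym (+-suc k (r v)))) (+-monoʳ-≤ k above))

  SS⇔bounded-walk : ∀ {v u} → SS G π v u ⇔ Σ (Walk G v u) (RankBounded (r u))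
  SS⇔bounded-walk {v} {u} = mk⇔ SS⇒bounded-walk (λ (p , bounded) → bounded-walk⇒SS (r u) (m≤m+n _ _) p bounded)

  B : ℕ
  B = suc n

  rankWeight : Fin n → Fin n → ℕ
  rankWeight x y = B ^ (r x ⊔ r y)

  rankWeight-isWeighting : IsWeighting G rankWeight
  rankWeight-isWeighting = (λ x y → cong (B ^_) (⊔-comm (r x) (r y))) , (λ x y _ → m^n>0 B (r x ⊔ r y))

  ∈-verts⇒B^r≤len : ∀ {v u x} (p : Walk G v u) → x ∈ verts p → x ≡ u ⊎ B ^ r x ≤ len rankWeight p
  ∈-verts⇒B^r≤len [] (here refl) = inj₁ refl
  ∈-verts⇒B^r≤len (cons {v} {w} e p) (here refl) =
    inj₂ (≤-trans (^-monoʳ-≤ B (m≤m⊔n (r v) (r w))) (m≤m+n _ _))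
  ∈-verts⇒B^r≤len (cons {v} {w} e p) (there x∈) with ∈-verts⇒B^r≤len p x∈
  ... | inj₁ x≡u = inj₁ x≡u
  ... | inj₂ B^x≤p = inj₂ (≤-trans B^x≤p (m≤n+m _ (rankWeight v w)))

  len≤edges*B^ : ∀ R {v u} (p : Walk G v u) → RankBounded R p → len rankWeight p ≤ edges p * B ^ R
  len≤edges*B^ R [] _ = z≤n
  len≤edges*B^ R (cons {v} {w} e p) bounded =
    +-mono-≤ (^-monoʳ-≤ B (⊔-lub (bounded v (here refl)) (bounded w (there (source∈verts p)))))
             (len≤edges*B^ R p (λ x x∈ → bounded x (there x∈)))

  simple⇒len<B^ : ∀ R {v u} (p : Walk G v u) → Unique (verts p) → RankBounded R p →
                  len rankWeight p < B ^ suc R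
  simple⇒len<B^ R p simple bounded = begin-strict
    len rankWeight p  ≤⟨ len≤edges*B^ R p bounded ⟩
    edges p * B ^ R   ≤⟨ *-monoˡ-≤ (B ^ R) (<⇒≤ (Unique⇒edges<n simple)) ⟩
    n * B ^ R         <⟨ m<n+m (n * B ^ R) (m^n>0 B R) ⟩
    B ^ suc R         ∎
    where open ≤-Reasoning

  len<B^⇒RankBounded : ∀ R {v u} (p : Walk G v u) → r u ≤ R → len rankWeight p < B ^ suc R → RankBounded R p
  len<B^⇒RankBounded R p u≤R short x x∈ with ∈-verts⇒B^r≤len p x∈
  ... | inj₁ refl = u≤R
  ... | inj₂ B^x≤p = ≮⇒≥ (λ R<x → <⇒≱ short (≤-trans (^-monoʳ-≤ B R<x) B^x≤p))

  InHHL⇔bounded-walk : ∀ {v u} → InHHL G rankWeight π v u ⇔ Σ (Walk G v u) (RankBounded (r u))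
  InHHL⇔bounded-walk {v} {u} = mk⇔ to from
    where
    to : InHHL G rankWeight π v u → Σ (Walk G v u) (RankBounded (r u))
    to (p₀ , maximal) with shortestWalk rankWeight p₀
    ... | p , shortest = p , maximal p shortest

    from : Σ (Walk G v u) (RankBounded (r u)) → InHHL G rankWeight π v u
    from (p , bounded) with simplify p
    ... | shortcut q simple q⊆p _ = p , λ p′ shortest →
      len<B^⇒RankBounded (r u) p′ ≤-refl
        (≤-<-trans (shortest q) (simple⇒len<B^ (r u) q simple (λ x x∈ → bounded x (q⊆p x∈))))

mainTheorem5 : ∀ (n : ℕ) (G : Graph n) (π : Permutation′ n) →
    Σ (Fin n → Fin n → ℕ) λ ℓ → IsWeighting G ℓ ×
      (∀ (v u : Fin n) → InHHL G ℓ π v u ⇔ SS G π v u)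
mainTheorem5 n G π =
  rankWeight G π , rankWeight-isWeighting G π ,
  λ v u → ⇔-sym (SS⇔bounded-walk G π) ⇔-∘ InHHL⇔bounded-walk G π
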